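{- If $T$ is a tree, then $b^A_g(T)\ge 0$ and $b^I_g(T)\ge 0$.
   Context: The balance game on a finite simple graph $G$ is played by two players, Admirable (A) and Impish (I), who alternately select a not-yet-labeled vertex of $G$ until all vertices are labeled; Admirable labels each vertex she selects by $0$ and Impish labels each vertex he selects by $1$. Each edge receives the sum modulo $2$ of the labels of its endpoints. Let $e_0$ and $e_1$ be the numbers of edges labeled $0$ and $1$ at the end; the discrepancy is $d=e_1-e_0$. Admirable tries to minimize $d$ and Impish tries to maximize $d$. $b^A_g(G)$ is the value of $d$ under optimal play of both players when Admirable moves first, and $b^I_g(G)$ is the value under optimal play when Impish moves first. -}

module Defs where

open import Data.Nat using (ℕ; zero; suc; _<_)
open import Data.Fin using (Fin; toℕ; _≟_)
open import Data.Fin.Properties using () renaming (_≟_ to _≟ᶠ_)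
open import Data.Bool using (Bool; true; false; if_then_else_; _xor_)
open import Data.Maybe using (Maybe; just; nothing; fromMaybe)
open import Data.Integer using (ℤ; +_; _-_; _⊓_; _⊔_)
open import Data.List using (List; []; _∷_; map; filter; length; allFin)
open import Data.List.Membership.Propositional using (_∈_)
open import Data.List.Relation.Unary.All using (All)
open import Data.List.Relation.Unary.Unique.Propositional using (Unique)
open import Data.Product using (_×_; _,_; proj₁; proj₂; Σ)
open import Data.Sum using (_⊎_)
open import Relation.Nullary using (¬_; yes; no)
open import Relation.Nullary.Decidable using (⌊_⌋)
open import Data.Maybe.Relation.Unary.Any using () renaming (Any to MAny)
open import Relation.Binary.PropositionalEquality using (_≡_)

-- Edges are stored as a duplicate-free list of pairs (u , v) with
-- toℕ u < toℕ v; this is exactly a set of 2-element subsets of Fin n,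
-- i.e. a finite simple graph (no loops, no multiple edges).

record Graph : Set where
  field
    n       : ℕ
    edges   : List (Fin n × Fin n)
    ordered : All (λ e → toℕ (proj₁ e) < toℕ (proj₂ e)) edges
    nodup   : Unique edges
open Graph public

Adj : (G : Graph) → Fin (n G) → Fin (n G) → Set
Adj G u v = ((u , v) ∈ edges G) ⊎ ((v , u) ∈ edges G)

data Walk (G : Graph) : Fin (n G) → Fin (n G) → Set where
  here  : ∀ {u} → Walk G u u
  step  : ∀ {u w v} → Adj G u w → Walk G w v → Walk G u v

Connected : Graph → Set
Connected G = ∀ u v → Walk G u v

data Chain (G : Graph) : Fin (n G) → List (Fin (n G)) → Fin (n G) → Set where
  end  : ∀ {u} → Chain G u [] u
  link : ∀ {u w ws v} → Adj G u w → Chain G w ws v → Chain G u (w ∷ ws) v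

record Cycle (G : Graph) : Set where
  field
    v₀ v₁ v₂ : Fin (n G)
    rest      : List (Fin (n G))
    last      : Fin (n G)
    chain     : Chain G v₀ (v₁ ∷ v₂ ∷ rest) last
    closing   : Adj G last v₀
    distinct  : Unique (v₀ ∷ v₁ ∷ v₂ ∷ rest)

Acyclic : Graph → Set
Acyclic G = ¬ Cycle G

IsTree : Graph → Set
IsTree G = (0 < n G) × Connected G × Acyclic G

-- The balance game.
-- A (partial) labelling: nothing = not yet selected,
-- just false = label 0 (Admirable), just true = label 1 (Impish).

Labelling : ℕ → Set
Labelling m = Fin m → Maybe Bool

data Player : Set where
  Admirable Impish : Player

other : Player → Player
other Admirable = Impish
other Impish    = Admirable

label : Player → Bool
label Admirable = false
label Impish    = true

set : ∀ {m} → Labelling m → Fin m → Bool → Labelling m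
set lab v b w with w ≟ᶠ v
... | yes _ = just b
... | no  _ = lab w

isUnlabelled : Maybe Bool → Bool
isUnlabelled nothing  = true
isUnlabelled (just _) = false

unlabelled : ∀ {m} → Labelling m → List (Fin m)
unlabelled lab = filter (λ v → Data.Bool._≟_ (isUnlabelled (lab v)) true) (allFin _)

edgeLabel : ∀ {m} → Labelling m → Fin m × Fin m → Bool
edgeLabel lab (u , v) = fromMaybe false (lab u) xor fromMaybe false (lab v)

discrepancy : (G : Graph) → Labelling (n G) → ℤ
discrepancy G lab =
    + length (filter (λ e → Data.Bool._≟_ (edgeLabel lab e) true) (edges G))
  - + length (filter (λ e → Data.Bool._≟_ (edgeLabel lab e) false) (edges G))

optimum : Player → ℤ → List ℤ → ℤ
optimum p x []       = x
optimum Admirable x (y ∷ ys) = x ⊓ optimum Admirable y ys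
optimum Impish    x (y ∷ ys) = x ⊔ optimum Impish y ys

-- value G k p lab : the value of the game from position lab with player p
-- to move, where k bounds the number of remaining moves (k = number of
-- unlabelled vertices when called from gameValue).
value : (G : Graph) → ℕ → Player → Labelling (n G) → ℤ
value G zero    p lab = discrepancy G lab
value G (suc k) p lab with map (λ v → value G k (other p) (set lab v (label p))) (unlabelled lab)
... | []     = discrepancy G lab
... | x ∷ xs = optimum p x xs

gameValue : Player → Graph → ℤ
gameValue p G = value G (n G) p (λ _ → nothing)

bA : Graph → ℤ
bA = gameValue Admirable

bI : Graph → ℤ
bI = gameValue Impish

-- Root T at a vertex r and take breadth-first parents. Pairing vertices greedily from the deepest
-- level up (a deepest unpaired vertex takes an unpaired sibling if there is one, and its parent
-- otherwise) gives an involution π fixing at most r that pairs every other vertex with a sibling,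
-- a child or its parent. Identify each edge with its endpoint farther from r: if c and π c always
-- carry different labels, a monochromatic edge at c gives a bichromatic edge at π c, injectively,
-- so e₀ ≤ e₁.
-- Impish forces such a labelling. He answers Admirable's move on v by taking π v; if he cannot
-- (v = r, or π v already carries his label) he moves on an arbitrary w, leaving π w as the only
-- "open" vertex whose move he could not answer. Keeping at most one open vertex guarantees that no
-- pair ends up with equal labels. Moving first, he starts with r.

module Submission where

open import Defs
open import Data.Bool using (Bool; true; false; _xor_) renaming (_≟_ to _≟ᵇ_)
open import Data.Bool.Properties using (xor-comm)
open import Data.Empty using (⊥-elim)
open import Data.Fin using (Fin; toℕ; fromℕ<)
open import Data.Fin.Properties using (_≟_; any?)
open import Data.Integer as ℤ using (ℤ; +_; +≤+; _≤_)
open import Data.Integer.Properties as ℤ using (i≤j⇒0≤j-i; ⊓-glb; i≤i⊔j; i≤j⊔i)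
open import Data.List using (List; []; _∷_; [_]; _++_; length; filter; map; allFin)
open import Data.List.Extrema.Nat using (argmax; argmax-all; f[⊥]≤f[argmax]; f[xs]≤f[argmax])
open import Data.List.Membership.Propositional using (_∈_; _∉_; find; lose)
open import Data.List.Membership.Propositional.Properties using (∈-filter⁺; ∈-filter⁻; ∈-allFin; ∈-map⁺)
open import Data.List.Properties using (filter-notAll; length-filter; length-tabulate)
open import Data.List.Relation.Unary.All as All using (All; []; _∷_)
open import Data.List.Relation.Unary.All.Properties using (¬Any⇒All¬) renaming (map⁺ to All-map⁺)
open import Data.List.Relation.Unary.Any as Any using (here; there)
open import Data.List.Relation.Unary.Unique.Propositional using (Unique; []; _∷_)
open import Data.List.Relation.Unary.Unique.Propositional.Properties using (allFin⁺) renaming (filter⁺ to Unique-filter⁺)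
open import Data.Maybe using (just; nothing; fromMaybe)
open import Data.Nat using (ℕ; zero; suc; _<_; z≤n; s≤s) renaming (_≤_ to _≤ℕ_)
open import Data.Nat.Induction using (<-wellFounded)
open import Data.Nat.Properties
  using (≤-refl; ≤-reflexive; ≤-trans; ≤-antisym; ≤-pred; <-trans; ≤-<-trans; <-≤-trans; <-irrefl; <-asym;
         ≮⇒≥; 1+n≰n; m<1+n⇒m<n∨m≡n; suc-injective)
open import Data.Product using (Σ; ∃; _×_; _,_; proj₁; proj₂)
open import Data.Product.Properties using (≡-dec)
open import Data.Sum using (_⊎_; inj₁; inj₂; [_,_]′; swap)
open import Function using (id; _∘_; case_of_)
open import Induction.WellFounded using (Acc; acc)
open import Relation.Binary.Definitions using (DecidableEquality; Symmetric)
open import Relation.Binary.PropositionalEquality using (_≡_; _≢_; refl; sym; trans; cong; subst; ≢-sym; module ≡-Reasoning)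
open import Relation.Nullary using (¬_; Dec; yes; no; ¬?; contradiction)
open import Relation.Nullary.Decidable using (_⊎-dec_; _×-dec_; decidable-stable)
open import Relation.Unary using (Decidable)

module _ {A B : Set} (_≟_ : DecidableEquality B) (f : A → B) where

  length-≤-of-injection : ∀ {xs : List A} {ys : List B} → Unique xs →
    (∀ {x} → x ∈ xs → f x ∈ ys) → (∀ {x y} → x ∈ xs → y ∈ xs → f x ≡ f y → x ≡ y) →
    length xs ≤ℕ length ys
  length-≤-of-injection {[]} _ _ _ = z≤n
  length-≤-of-injection {x ∷ xs} {ys} (x∉xs ∷ unique) into injective =
    ≤-<-trans (length-≤-of-injection unique into′ injective′)
              (filter-notAll (λ y → ¬? (y ≟ f x)) ys
                             (Any.map (λ { refl fx≢fx → fx≢fx refl }) (into (here refl))))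
    where
    into′ : ∀ {y} → y ∈ xs → f y ∈ filter (λ y → ¬? (y ≟ f x)) ys
    into′ y∈xs = ∈-filter⁺ (λ y → ¬? (y ≟ f x)) (into (there y∈xs))
                   (λ fy≡fx → All.lookup x∉xs y∈xs (sym (injective (there y∈xs) (here refl) fy≡fx)))
    injective′ : ∀ {y z} → y ∈ xs → z ∈ xs → f y ≡ f z → y ≡ z
    injective′ y∈xs z∈xs = injective (there y∈xs) (there z∈xs)

least : ∀ {P : ℕ → Set} → Decidable P → ∀ {m} → P m → Σ ℕ λ k → P k × (∀ {j} → P j → k ≤ℕ j)
least {P} P? {m} pm = [ (λ none → ⊥-elim (none ≤-refl pm)) , id ]′ (search (suc m))
  where
  search : ∀ m → (∀ {j} → j < m → ¬ P j) ⊎ Σ ℕ λ k → P k × (∀ {j} → P j → k ≤ℕ j)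
  search zero = inj₁ λ ()
  search (suc m) with search m
  ... | inj₂ found = inj₂ found
  ... | inj₁ none with P? m
  ...   | yes pm = inj₂ (m , pm , λ pj → ≮⇒≥ (λ j<m → none j<m pj))
  ...   | no ¬pm = inj₁ λ j<1+m → [ none , (λ { refl → ¬pm }) ]′ (m<1+n⇒m<n∨m≡n j<1+m)

length≤0⇒[] : ∀ {A : Set} {xs : List A} → length xs ≤ℕ 0 → xs ≡ []
length≤0⇒[] {xs = []} _ = refl

module Paths {A : Set} (R : A → A → Set) where

  data Path : A → List A → A → Set where
    end  : ∀ {x} → Path x [] x
    link : ∀ {x y ys z} → R x y → Path y ys z → Path x (y ∷ ys) z

  _++ᵖ_ : ∀ {x xs y ys z} → Path x xs y → Path y ys z → Path x (xs ++ ys) z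
  end       ++ᵖ q = q
  link xy p ++ᵖ q = link xy (p ++ᵖ q)

  reverse : Symmetric R → ∀ {x xs y} → Path x xs y → ∃ λ ys → Path y ys x
  reverse R-sym end         = [] , end
  reverse R-sym (link xy p) with ys , q ← reverse R-sym p = ys ++ [ _ ] , q ++ᵖ link (R-sym xy) end

  module _ (_≟_ : DecidableEquality A) where
    open import Data.List.Membership.DecPropositional _≟_ using (_∈?_)

    SimplePath : A → A → Set
    SimplePath x z = ∃ λ ys → Path x ys z × Unique (x ∷ ys)

    suffix : ∀ {x xs z y} → Path x xs z → Unique (x ∷ xs) → y ∈ x ∷ xs → SimplePath y z
    suffix p          unique       (here refl)  = _ , p , unique
    suffix (link _ p) (_ ∷ unique) (there y∈xs) = suffix p unique y∈xs

    shorten : ∀ {x xs z} → Path x xs z → SimplePath x z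
    shorten end = [] , end , [] ∷ []
    shorten {x} (link {y = y} xy p) with shorten p
    ... | ys , q , unique with x ∈? y ∷ ys
    ...   | yes x∈ = suffix q unique x∈
    ...   | no x∉  = y ∷ ys , link xy q , ¬Any⇒All¬ (y ∷ ys) x∉ ∷ unique

labelOf : ∀ {m} → Labelling m → Fin m → Bool
labelOf lab v = fromMaybe false (lab v)

Balanced : ∀ {m} → (Fin m → Fin m) → Labelling m → Set
Balanced π lab = ∀ v → π v ≢ v → labelOf lab v ≢ labelOf lab (π v)

module _ {m : ℕ} where

  set-≡ : ∀ (lab : Labelling m) v b → set lab v b v ≡ just b
  set-≡ lab v b with v ≟ v
  ... | yes _   = refl
  ... | no v≢v  = ⊥-elim (v≢v refl)

  set-≢ : ∀ (lab : Labelling m) {v} b {x} → x ≢ v → set lab v b x ≡ lab x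
  set-≢ lab {v} b {x} x≢v with x ≟ v
  ... | yes x≡v = ⊥-elim (x≢v x≡v)
  ... | no _    = refl

  set-just⁻ : ∀ (lab : Labelling m) {v b} x {c} → set lab v b x ≡ just c → (x ≡ v × b ≡ c) ⊎ lab x ≡ just c
  set-just⁻ lab {v} {b} x eq with x ≟ v | eq
  ... | yes x≡v | refl = inj₁ (x≡v , refl)
  ... | no _    | eq′  = inj₂ eq′

  set-nothing⁻ : ∀ (lab : Labelling m) {v b} x → set lab v b x ≡ nothing → x ≢ v × lab x ≡ nothing
  set-nothing⁻ lab {v} {b} x eq with x ≟ v | eq
  ... | yes _  | ()
  ... | no x≢v | eq′ = x≢v , eq′

  set-extends : ∀ (lab : Labelling m) {v b x c} → lab v ≡ nothing → lab x ≡ just c → set lab v b x ≡ just c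
  set-extends lab {v} {b} {x} lv≡nothing lx≡just = trans (set-≢ lab b x≢v) lx≡just
    where
    x≢v : x ≢ v
    x≢v refl with () ← trans (sym lx≡just) lv≡nothing

  ∈-unlabelled⁺ : ∀ (lab : Labelling m) {v} → lab v ≡ nothing → v ∈ unlabelled lab
  ∈-unlabelled⁺ lab {v} lv≡nothing =
    ∈-filter⁺ (λ v → isUnlabelled (lab v) ≟ᵇ true) (∈-allFin v) (cong isUnlabelled lv≡nothing)

  ∈-unlabelled⁻ : ∀ (lab : Labelling m) {v} → v ∈ unlabelled lab → lab v ≡ nothing
  ∈-unlabelled⁻ lab {v} v∈ with lab v | proj₂ (∈-filter⁻ (λ v → isUnlabelled (lab v) ≟ᵇ true) {xs = allFin m} v∈)
  ... | nothing | _ = refl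

  complete⇒labelled : ∀ (lab : Labelling m) → unlabelled lab ≡ [] → ∀ {v} → lab v ≢ nothing
  complete⇒labelled lab complete lv≡nothing with () ← subst (_ ∈_) complete (∈-unlabelled⁺ lab lv≡nothing)

  unique-unlabelled : ∀ (lab : Labelling m) → Unique (unlabelled lab)
  unique-unlabelled lab = Unique-filter⁺ (λ v → isUnlabelled (lab v) ≟ᵇ true) (allFin⁺ m)

  length-unlabelled : ∀ (lab : Labelling m) → length (unlabelled lab) ≤ℕ m
  length-unlabelled lab = ≤-trans (length-filter (λ v → isUnlabelled (lab v) ≟ᵇ true) (allFin m))
                              (≤-reflexive (length-tabulate id))

  unlabelled-set : ∀ (lab : Labelling m) {v} b → lab v ≡ nothing →
                   length (unlabelled (set lab v b)) < length (unlabelled lab)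
  unlabelled-set lab {v} b lv≡nothing =
    length-≤-of-injection _≟_ id (All.tabulate v≢ ∷ unique-unlabelled (set lab v b)) into (λ _ _ eq → eq)
    where
    v≢ : ∀ {x} → x ∈ unlabelled (set lab v b) → v ≢ x
    v≢ x∈ refl with () ← trans (sym (set-≡ lab v b)) (∈-unlabelled⁻ (set lab v b) x∈)
    into : ∀ {x} → x ∈ v ∷ unlabelled (set lab v b) → x ∈ unlabelled lab
    into (here refl) = ∈-unlabelled⁺ lab lv≡nothing
    into (there x∈)  = ∈-unlabelled⁺ lab (proj₂ (set-nothing⁻ lab _ (∈-unlabelled⁻ (set lab v b) x∈)))

outcome : ℤ → Player → List ℤ → ℤ
outcome d p []       = d
outcome d p (x ∷ xs) = optimum p x xs

value-suc : ∀ G k p lab → value G (suc k) p lab ≡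
  outcome (discrepancy G lab) p (map (λ v → value G k (other p) (set lab v (label p))) (unlabelled lab))
value-suc G k p lab with map (λ v → value G k (other p) (set lab v (label p))) (unlabelled lab)
... | []    = refl
... | _ ∷ _ = refl

optimum-Admirable-≥ : ∀ {z} x xs → z ≤ x → All (z ≤_) xs → z ≤ optimum Admirable x xs
optimum-Admirable-≥ x []       z≤x []            = z≤x
optimum-Admirable-≥ x (y ∷ ys) z≤x (z≤y ∷ z≤ys) = ⊓-glb z≤x (optimum-Admirable-≥ y ys z≤y z≤ys)

optimum-Impish-≥ : ∀ {y} x xs → y ∈ x ∷ xs → y ≤ optimum Impish x xs
optimum-Impish-≥ x []       (here refl)   = ℤ.≤-refl
optimum-Impish-≥ x (z ∷ zs) (here refl)   = i≤i⊔j x (optimum Impish z zs)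
optimum-Impish-≥ x (z ∷ zs) (there y∈zs) =
  ℤ.≤-trans (optimum-Impish-≥ z zs y∈zs) (i≤j⊔i x (optimum Impish z zs))

outcome-map-Admirable-≥ : ∀ {A : Set} (f : A → ℤ) {z d} xs → (xs ≡ [] → z ≤ d) →
                          (∀ {x} → x ∈ xs → z ≤ f x) →
                          z ≤ outcome d Admirable (map f xs)
outcome-map-Admirable-≥ f []       done _    = done refl
outcome-map-Admirable-≥ f (x ∷ xs) _    next =
  optimum-Admirable-≥ (f x) (map f xs) (next (here refl)) (All-map⁺ (All.tabulate (next ∘ there)))

outcome-map-Impish-≥ : ∀ {A : Set} (f : A → ℤ) {d x} xs → x ∈ xs → f x ≤ outcome d Impish (map f xs)
outcome-map-Impish-≥ f (y ∷ ys) x∈ = optimum-Impish-≥ (f y) (map f ys) (∈-map⁺ f x∈)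

module _ (G : Graph) where

  -- The first argument of value is fuel: value G k p lab is the game value for every k at least
  -- the number of unlabelled vertices.
  ValueAtLeast : ℤ → Player → Labelling (n G) → Set
  ValueAtLeast z p lab = ∀ k → length (unlabelled lab) ≤ℕ k → z ≤ value G k p lab

  atLeast-complete : ∀ {z p lab} → unlabelled lab ≡ [] → z ≤ discrepancy G lab → ValueAtLeast z p lab
  atLeast-complete {z} {p} {lab} complete z≤d k _ = subst (z ≤_) (sym (value-complete k)) z≤d
    where
    value-complete : ∀ k → value G k p lab ≡ discrepancy G lab
    value-complete zero    = refl
    value-complete (suc k) rewrite value-suc G k p lab | complete = refl

  atLeast-Admirable : ∀ {z lab} → (unlabelled lab ≡ [] → z ≤ discrepancy G lab) →
                      (∀ {v} → v ∈ unlabelled lab → ValueAtLeast z Impish (set lab v false)) →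
                      ValueAtLeast z Admirable lab
  atLeast-Admirable done next zero    bound = done (length≤0⇒[] bound)
  atLeast-Admirable {lab = lab} done next (suc k) bound rewrite value-suc G k Admirable lab =
    outcome-map-Admirable-≥ _ (unlabelled lab) done λ v∈ →
      next v∈ k (≤-pred (<-≤-trans (unlabelled-set lab false (∈-unlabelled⁻ lab v∈)) bound))

  atLeast-Impish : ∀ {z lab v} → v ∈ unlabelled lab → ValueAtLeast z Admirable (set lab v true) →
                   ValueAtLeast z Impish lab
  atLeast-Impish v∈ next zero bound = contradiction (subst (_ ∈_) (length≤0⇒[] bound) v∈) λ ()
  atLeast-Impish {lab = lab} v∈ next (suc k) bound rewrite value-suc G k Impish lab =
    ℤ.≤-trans (next k (≤-pred (<-≤-trans (unlabelled-set lab true (∈-unlabelled⁻ lab v∈)) bound)))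
             (outcome-map-Impish-≥ _ (unlabelled lab) v∈)

  atLeast-Impish-any : ∀ {z lab} → (unlabelled lab ≡ [] → z ≤ discrepancy G lab) →
                       (∀ {w} → w ∈ unlabelled lab → ValueAtLeast z Admirable (set lab w true)) →
                       ValueAtLeast z Impish lab
  atLeast-Impish-any {z} {lab} done next = byCases (unlabelled lab) refl
    where
    byCases : ∀ ws → unlabelled lab ≡ ws → ValueAtLeast z Impish lab
    byCases []      complete = atLeast-complete complete (done complete)
    byCases (w ∷ _) eq       = atLeast-Impish w∈ (next w∈)
      where
      w∈ : w ∈ unlabelled lab
      w∈ = subst (w ∈_) (sym eq) (here refl)

module PairingStrategy (G : Graph) (π : Fin (n G) → Fin (n G)) (involutive : ∀ v → π (π v) ≡ v)
                       (r : Fin (n G)) (fixed⇒root : ∀ {v} → π v ≡ v → v ≡ r) where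

  Lab : Set
  Lab = Labelling (n G)

  π-injective : ∀ {x y} → π x ≡ π y → x ≡ y
  π-injective {x} {y} eq = trans (sym (involutive x)) (trans (cong π eq) (involutive y))

  Open : Lab → Fin (n G) → Set
  Open lab u = lab u ≡ nothing × (π u ≡ u ⊎ lab (π u) ≡ just true)

  -- Impish's invariant whenever Admirable is to move.
  record Safe (lab : Lab) : Set where
    field
      answered   : ∀ {x} → π x ≢ x → lab x ≡ just false → lab (π x) ≡ just true
      notBoth    : ∀ {x} → π x ≢ x → lab x ≡ just true → lab (π x) ≢ just true
      openUnique : ∀ {u u′} → Open lab u → Open lab u′ → u ≡ u′

  safe-empty : Safe (λ _ → nothing)
  safe-empty = record { answered = λ _ () ; notBoth = λ _ () ; openUnique = unique }
    where
    unique : ∀ {u u′} → Open (λ _ → nothing) u → Open (λ _ → nothing) u′ → u ≡ u′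
    unique (_ , inj₁ fixed) (_ , inj₁ fixed′) = trans (fixed⇒root fixed) (sym (fixed⇒root fixed′))

  safe-root : Safe (set (λ _ → nothing) r true)
  safe-root = record
    { answered   = answered
    ; notBoth    = notBoth
    ; openUnique = λ u-open u′-open → trans (open⇒πr u-open) (sym (open⇒πr u′-open))
    }
    where
    lab₀ : Lab
    lab₀ = set (λ _ → nothing) r true
    labelled⇒root : ∀ x {c} → lab₀ x ≡ just c → x ≡ r × true ≡ c
    labelled⇒root x lx with set-just⁻ (λ _ → nothing) x lx
    ... | inj₁ x≡r,true≡c = x≡r,true≡c
    answered : ∀ {x} → π x ≢ x → lab₀ x ≡ just false → lab₀ (π x) ≡ just true
    answered {x} _ lx with () ← proj₂ (labelled⇒root x lx)
    notBoth : ∀ {x} → π x ≢ x → lab₀ x ≡ just true → lab₀ (π x) ≢ just true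
    notBoth {x} πx≢x lx lπx =
      πx≢x (trans (proj₁ (labelled⇒root (π x) lπx)) (sym (proj₁ (labelled⇒root x lx))))
    open⇒πr : ∀ {u} → Open lab₀ u → u ≡ π r
    open⇒πr {u} (lu , inj₁ fixed) = ⊥-elim (proj₁ (set-nothing⁻ (λ _ → nothing) u lu) (fixed⇒root fixed))
    open⇒πr {u} (_ , inj₂ lπu)    = trans (sym (involutive u)) (cong π (proj₁ (labelled⇒root (π u) lπu)))

  module _ {lab : Lab} (safe : Safe lab) where
    open Safe safe

    answer-or-open : ∀ {v} → lab v ≡ nothing → (π v ≢ v × lab (π v) ≡ nothing) ⊎ Open lab v
    answer-or-open {v} lv with π v ≟ v | lab (π v) in lπv
    ... | yes fixed | _          = inj₂ (lv , inj₁ fixed)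
    ... | no moved  | nothing    = inj₁ (moved , refl)
    ... | no moved  | just true  = inj₂ (lv , inj₂ refl)
    ... | no moved  | just false with () ←
      trans (sym lv) (trans (cong lab (sym (involutive v))) (answered (moved ∘ π-injective) lπv))

    safe-balanced : unlabelled lab ≡ [] → Balanced π lab
    safe-balanced complete x πx≢x with lab x in lx | lab (π x) in lπx
    ... | nothing    | _          = ⊥-elim (complete⇒labelled lab complete lx)
    ... | just _     | nothing    = ⊥-elim (complete⇒labelled lab complete lπx)
    ... | just false | just true  = λ ()
    ... | just true  | just false = λ ()
    ... | just true  | just true  = ⊥-elim (notBoth πx≢x lx lπx)
    ... | just false | just false with () ← trans (sym lπx) (answered πx≢x lx)

    safe-answer : ∀ {v} → π v ≢ v → lab v ≡ nothing → lab (π v) ≡ nothing →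
                  Safe (set (set lab v false) (π v) true)
    safe-answer {v} moved lv lπv = record { answered = answered′ ; notBoth = notBoth′ ; openUnique = openUnique′ }
      where
      lab₁ lab₂ : Lab
      lab₁ = set lab v false
      lab₂ = set lab₁ (π v) true

      lab₁-πv : lab₁ (π v) ≡ nothing
      lab₁-πv = trans (set-≢ lab false moved) lπv

      extends : ∀ {x c} → lab x ≡ just c → lab₂ x ≡ just c
      extends {x} lx = set-extends lab₁ {x = x} lab₁-πv (set-extends lab lv lx)

      lab₂-v : lab₂ v ≡ just false
      lab₂-v = trans (set-≢ lab₁ true (moved ∘ sym)) (set-≡ lab v false)

      just⁻ : ∀ x {c} → lab₂ x ≡ just c → (x ≡ π v × c ≡ true) ⊎ (x ≡ v × c ≡ false) ⊎ lab x ≡ just c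
      just⁻ x l₂x with set-just⁻ lab₁ x l₂x
      ... | inj₁ (x≡πv , refl) = inj₁ (x≡πv , refl)
      ... | inj₂ l₁x with set-just⁻ lab x l₁x
      ...   | inj₁ (x≡v , refl) = inj₂ (inj₁ (x≡v , refl))
      ...   | inj₂ lx           = inj₂ (inj₂ lx)

      answered′ : ∀ {x} → π x ≢ x → lab₂ x ≡ just false → lab₂ (π x) ≡ just true
      answered′ {x} πx≢x l₂x with just⁻ x l₂x
      ... | inj₁ (_ , ())
      ... | inj₂ (inj₁ (refl , _)) = set-≡ lab₁ (π v) true
      ... | inj₂ (inj₂ lx)         = extends (answered πx≢x lx)

      notBoth′ : ∀ {x} → π x ≢ x → lab₂ x ≡ just true → lab₂ (π x) ≢ just true
      notBoth′ {x} πx≢x l₂x l₂πx with just⁻ x l₂x | just⁻ (π x) l₂πx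
      ... | inj₁ (refl , _)        | _ with () ← trans (sym l₂πx) (trans (cong lab₂ (involutive v)) lab₂-v)
      ... | inj₂ (inj₁ (_ , ()))   | _
      ... | inj₂ (inj₂ lx)         | inj₁ (πx≡πv , _)
            with () ← trans (sym lx) (trans (cong lab (π-injective πx≡πv)) lv)
      ... | inj₂ (inj₂ _)          | inj₂ (inj₁ (_ , ()))
      ... | inj₂ (inj₂ lx)         | inj₂ (inj₂ lπx) = notBoth πx≢x lx lπx

      open⁻ : ∀ {u} → Open lab₂ u → Open lab u
      open⁻ {u} (l₂u , partner) with _ , l₁u ← set-nothing⁻ lab₁ u l₂u
                                with u≢v , lu ← set-nothing⁻ lab u l₁u =
        lu , fromPartner partner
        where
        fromPartner : π u ≡ u ⊎ lab₂ (π u) ≡ just true → π u ≡ u ⊎ lab (π u) ≡ just true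
        fromPartner (inj₁ fixed) = inj₁ fixed
        fromPartner (inj₂ l₂πu) with just⁻ (π u) l₂πu
        ... | inj₁ (πu≡πv , _)     = ⊥-elim (u≢v (π-injective πu≡πv))
        ... | inj₂ (inj₁ (_ , ()))
        ... | inj₂ (inj₂ lπu)      = inj₂ lπu

      openUnique′ : ∀ {u u′} → Open lab₂ u → Open lab₂ u′ → u ≡ u′
      openUnique′ u-open u′-open = openUnique (open⁻ u-open) (open⁻ u′-open)

    module _ {v} (v-open : Open lab v) where
      private
        lab₁ : Lab
        lab₁ = set lab v false

        true⁻ : ∀ x → lab₁ x ≡ just true → lab x ≡ just true
        true⁻ x l₁x with set-just⁻ lab x l₁x
        ... | inj₁ (_ , ())
        ... | inj₂ lx = lx

      close-settles : ∀ {u} → ¬ Open lab₁ u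
      close-settles {u} (l₁u , partner) with u≢v , lu ← set-nothing⁻ lab u l₁u =
        u≢v (openUnique (lu , fromPartner partner) v-open)
        where
        fromPartner : π u ≡ u ⊎ lab₁ (π u) ≡ just true → π u ≡ u ⊎ lab (π u) ≡ just true
        fromPartner (inj₁ fixed) = inj₁ fixed
        fromPartner (inj₂ l₁πu)  = inj₂ (true⁻ (π u) l₁πu)

      safe-close : Safe lab₁
      safe-close = record
        { answered   = answered′
        ; notBoth    = λ {x} πx≢x l₁x l₁πx → notBoth πx≢x (true⁻ x l₁x) (true⁻ (π x) l₁πx)
        ; openUnique = λ u-open _ → ⊥-elim (close-settles u-open)
        }
        where
        answered′ : ∀ {x} → π x ≢ x → lab₁ x ≡ just false → lab₁ (π x) ≡ just true
        answered′ {x} πx≢x l₁x with set-just⁻ lab x l₁x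
        ... | inj₁ (refl , _) =
          set-extends lab (proj₁ v-open) ([ (λ fixed → ⊥-elim (πx≢x fixed)) , id ]′ (proj₂ v-open))
        ... | inj₂ lx         = set-extends lab (proj₁ v-open) (answered πx≢x lx)

    safe-free : (∀ {u} → ¬ Open lab u) → ∀ {w} → lab w ≡ nothing → Safe (set lab w true)
    safe-free settled {w} lw = record { answered = answered′ ; notBoth = notBoth′ ; openUnique = openUnique′ }
      where
      lab₂ : Lab
      lab₂ = set lab w true

      true⁻ : ∀ x → lab₂ x ≡ just true → x ≡ w ⊎ lab x ≡ just true
      true⁻ x l₂x with set-just⁻ lab x l₂x
      ... | inj₁ (x≡w , _) = inj₁ x≡w
      ... | inj₂ lx        = inj₂ lx

      answered′ : ∀ {x} → π x ≢ x → lab₂ x ≡ just false → lab₂ (π x) ≡ just true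
      answered′ {x} πx≢x l₂x with set-just⁻ lab x l₂x
      ... | inj₁ (_ , ())
      ... | inj₂ lx = set-extends lab lw (answered πx≢x lx)

      notBoth′ : ∀ {x} → π x ≢ x → lab₂ x ≡ just true → lab₂ (π x) ≢ just true
      notBoth′ {x} πx≢x l₂x l₂πx with true⁻ x l₂x | true⁻ (π x) l₂πx
      ... | inj₁ refl | inj₁ πx≡x = πx≢x πx≡x
      ... | inj₁ refl | inj₂ lπx  = settled (lw , inj₂ lπx)
      ... | inj₂ lx   | inj₁ refl = settled (lw , inj₂ (trans (cong lab (involutive x)) lx))
      ... | inj₂ lx   | inj₂ lπx  = notBoth πx≢x lx lπx

      open⇒partner : ∀ {u} → Open lab₂ u → π u ≡ w
      open⇒partner {u} (l₂u , partner) with _ , lu ← set-nothing⁻ lab u l₂u | partner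
      ... | inj₁ fixed = ⊥-elim (settled (lu , inj₁ fixed))
      ... | inj₂ l₂πu with true⁻ (π u) l₂πu
      ...   | inj₁ πu≡w = πu≡w
      ...   | inj₂ lπu  = ⊥-elim (settled (lu , inj₂ lπu))

      openUnique′ : ∀ {u u′} → Open lab₂ u → Open lab₂ u′ → u ≡ u′
      openUnique′ u-open u′-open = π-injective (trans (open⇒partner u-open) (sym (open⇒partner u′-open)))

  module _ {z : ℤ} (balanced⇒z : ∀ lab → Balanced π lab → z ≤ discrepancy G lab) where

    finish : ∀ {lab} → Safe lab → unlabelled lab ≡ [] → z ≤ discrepancy G lab
    finish {lab} safe complete = balanced⇒z lab (safe-balanced safe complete)

    strategy : ∀ lab → Acc _<_ (length (unlabelled lab)) → Safe lab → ValueAtLeast G z Admirable lab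
    strategy lab (acc smaller) safe = atLeast-Admirable G (finish safe) reply
      where
      reply : ∀ {v} → v ∈ unlabelled lab → ValueAtLeast G z Impish (set lab v false)
      reply {v} v∈ with lv ← ∈-unlabelled⁻ lab v∈ with answer-or-open safe lv
      ... | inj₁ (moved , lπv) =
        atLeast-Impish G (∈-unlabelled⁺ lab₁ l₁πv)
          (strategy _ (smaller (<-trans (unlabelled-set lab₁ true l₁πv) (unlabelled-set lab false lv)))
                    (safe-answer safe moved lv lπv))
        where
        lab₁ : Lab
        lab₁ = set lab v false
        l₁πv : lab₁ (π v) ≡ nothing
        l₁πv = trans (set-≢ lab false moved) lπv
      ... | inj₂ v-open =
        atLeast-Impish-any G (finish (safe-close safe v-open)) λ {w} w∈ →
          let lw = ∈-unlabelled⁻ (set lab v false) w∈ in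
          strategy _ (smaller (<-trans (unlabelled-set (set lab v false) true lw) (unlabelled-set lab false lv)))
                   (safe-free (safe-close safe v-open) (close-settles safe v-open) lw)

    admirable-first : z ≤ bA G
    admirable-first = strategy _ (<-wellFounded _) safe-empty (n G) (length-unlabelled _)

    impish-first : z ≤ bI G
    impish-first = atLeast-Impish G (∈-unlabelled⁺ (λ _ → nothing) refl)
                     (strategy _ (<-wellFounded _) safe-root) (n G) (length-unlabelled _)

xor≡false⇒≡ : ∀ a b → a xor b ≡ false → a ≡ b
xor≡false⇒≡ false false _ = refl
xor≡false⇒≡ true  true  _ = refl

≢⇒xor≡true : ∀ {a b} → a ≢ b → a xor b ≡ true
≢⇒xor≡true {false} {false} a≢b = ⊥-elim (a≢b refl)
≢⇒xor≡true {false} {true}  _   = refl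
≢⇒xor≡true {true}  {false} _   = refl
≢⇒xor≡true {true}  {true}  a≢b = ⊥-elim (a≢b refl)

module Rooted (G : Graph) (r : Fin (n G)) (conn : Connected G) where

  V : Set
  V = Fin (n G)

  _≟ᵉ_ : DecidableEquality (V × V)
  _≟ᵉ_ = ≡-dec _≟_ _≟_

  open import Data.List.Membership.DecPropositional _≟ᵉ_ using (_∈?_)

  adj? : ∀ u v → Dec (Adj G u v)
  adj? u v = ((u , v) ∈? edges G) ⊎-dec ((v , u) ∈? edges G)

  Within : ℕ → V → Set
  Within zero    v = v ≡ r
  Within (suc k) v = Within k v ⊎ ∃ λ w → Adj G v w × Within k w

  within? : ∀ k → Decidable (Within k)
  within? zero    v = v ≟ r
  within? (suc k) v = within? k v ⊎-dec any? (λ w → adj? v w ×-dec within? k w)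

  walkLength : ∀ {u v} → Walk G u v → ℕ
  walkLength here       = zero
  walkLength (step _ p) = suc (walkLength p)

  walk⇒within : ∀ {v} (p : Walk G v r) → Within (walkLength p) v
  walk⇒within here         = refl
  walk⇒within (step uv p) = inj₂ (_ , uv , walk⇒within p)

  opaque
    distance : ∀ v → Σ ℕ λ k → Within k v × (∀ {j} → Within j v → k ≤ℕ j)
    distance v = least (λ k → within? k v) (walk⇒within (conn v r))

  depth : V → ℕ
  depth v = proj₁ (distance v)

  within-depth : ∀ v → Within (depth v) v
  within-depth v = proj₁ (proj₂ (distance v))

  depth-minimal : ∀ {v j} → Within j v → depth v ≤ℕ j
  depth-minimal {v} = proj₂ (proj₂ (distance v))

  depth≡0⇒root : ∀ {v} → depth v ≡ 0 → v ≡ r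
  depth≡0⇒root {v} d≡0 = subst (λ k → Within k v) d≡0 (within-depth v)

  private
    towardsRoot : ∀ v → Σ V λ w → v ≢ r → Adj G v w × suc (depth w) ≡ depth v
    towardsRoot v = go (depth v) (within-depth v) depth-minimal
      where
      go : ∀ k → Within k v → (∀ {j} → Within j v → k ≤ℕ j) →
           Σ V λ w → v ≢ r → Adj G v w × suc (depth w) ≡ k
      go zero          v≡r               _       = v , λ v≢r → ⊥-elim (v≢r v≡r)
      go (suc k)       (inj₁ within-k)   minimal = v , λ _ → ⊥-elim (1+n≰n (minimal within-k))
      go (suc k)       (inj₂ (w , vw , within-k)) minimal =
        w , λ _ → vw , ≤-antisym (s≤s (depth-minimal within-k)) (minimal (inj₂ (w , vw , within-depth w)))

  -- parent r = r is junk; every fact about parent v assumes v ≢ r.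
  parent : V → V
  parent v = proj₁ (towardsRoot v)

  parent-adj : ∀ {v} → v ≢ r → Adj G v (parent v)
  parent-adj {v} v≢r = proj₁ (proj₂ (towardsRoot v) v≢r)

  depth-parent : ∀ {v} → v ≢ r → suc (depth (parent v)) ≡ depth v
  depth-parent {v} v≢r = proj₂ (proj₂ (towardsRoot v) v≢r)

  ChildOf : V → V → Set
  ChildOf x y = x ≢ r × parent x ≡ y

  childOf? : ∀ x y → Dec (ChildOf x y)
  childOf? x y = ¬? (x ≟ r) ×-dec (parent x ≟ y)

  childOf⇒depth< : ∀ {x y} → ChildOf x y → depth y < depth x
  childOf⇒depth< (x≢r , refl) = ≤-reflexive (depth-parent x≢r)

  TreeEdge : V → V → Set
  TreeEdge x y = ChildOf x y ⊎ ChildOf y x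

  open Paths TreeEdge

  pathToRoot : ∀ v → ∃ λ xs → Path v xs r
  pathToRoot v = go (depth v) refl
    where
    go : ∀ {v} k → depth v ≡ k → ∃ λ xs → Path v xs r
    go {v} zero    d≡0 = [] , subst (Path v []) (depth≡0⇒root d≡0) end
    go {v} (suc k) d≡k with v ≟ r
    ... | yes refl = [] , end
    ... | no v≢r with xs , p ← go k (suc-injective (trans (depth-parent v≢r) d≡k)) =
      parent v ∷ xs , link (inj₁ (v≢r , refl)) p

  treePath : ∀ u v → ∃ λ xs → Path u xs v
  treePath u v with xs , p ← pathToRoot u | ys , q ← reverse swap (proj₂ (pathToRoot v)) = xs ++ ys , p ++ᵖ q

  Sibling : V → V → Set
  Sibling x y = x ≢ y × x ≢ r × y ≢ r × parent x ≡ parent y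

  sibling? : ∀ x y → Dec (Sibling x y)
  sibling? x y = ¬? (x ≟ y) ×-dec ¬? (x ≟ r) ×-dec ¬? (y ≟ r) ×-dec (parent x ≟ parent y)

  depth-sibling : ∀ {x y} → Sibling x y → depth x ≡ depth y
  depth-sibling {x} {y} (_ , x≢r , y≢r , px≡py) =
    trans (sym (depth-parent {x} x≢r)) (trans (cong (suc ∘ depth) px≡py) (depth-parent {y} y≢r))

  Kin : V → V → Set
  Kin x y = Sibling x y ⊎ TreeEdge x y

  kin-sym : ∀ {x y} → Kin x y → Kin y x
  kin-sym (inj₁ (x≢y , x≢r , y≢r , px≡py)) = inj₁ (≢-sym x≢y , y≢r , x≢r , sym px≡py)
  kin-sym (inj₂ edge)                      = inj₂ (swap edge)

  kin-irrefl : ∀ {x} → ¬ Kin x x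
  kin-irrefl (inj₁ (x≢x , _))    = x≢x refl
  kin-irrefl (inj₂ (inj₁ child)) = <-irrefl refl (childOf⇒depth< child)
  kin-irrefl (inj₂ (inj₂ child)) = <-irrefl refl (childOf⇒depth< child)

  ParentClosed : List V → Set
  ParentClosed A = ∀ {v} → v ∈ A → v ≢ r → parent v ∈ A

  record Pairing (A : List V) : Set where
    field
      partner       : V → V
      involutive    : ∀ v → partner (partner v) ≡ v
      fixes-outside : ∀ {v} → v ∉ A → partner v ≡ v
      kin           : ∀ {v} → v ∈ A → v ≢ r → Kin v (partner v)

  moves : ∀ {A} (P : Pairing A) → ∀ {v} → v ∈ A → v ≢ r → Pairing.partner P v ≢ v
  moves P v∈A v≢r πv≡v = kin-irrefl (subst (Kin _) πv≡v (Pairing.kin P v∈A v≢r))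

  identityPairing : ∀ {A} → (∀ {v} → v ∈ A → v ≡ r) → Pairing A
  identityPairing onlyRoot = record
    { partner = λ v → v ; involutive = λ _ → refl ; fixes-outside = λ _ → refl
    ; kin = λ v∈A v≢r → ⊥-elim (v≢r (onlyRoot v∈A)) }

  opaque
    remove₂ : V → V → List V → List V
    remove₂ x z = filter (λ v → ¬? (v ≟ x) ×-dec ¬? (v ≟ z))

    ∈-remove₂⁻ : ∀ {x z A v} → v ∈ remove₂ x z A → v ∈ A × v ≢ x × v ≢ z
    ∈-remove₂⁻ = ∈-filter⁻ (λ v → ¬? (v ≟ _) ×-dec ¬? (v ≟ _))

    ∈-remove₂⁺ : ∀ {x z A v} → v ∈ A → v ≢ x → v ≢ z → v ∈ remove₂ x z A
    ∈-remove₂⁺ v∈A v≢x v≢z = ∈-filter⁺ (λ v → ¬? (v ≟ _) ×-dec ¬? (v ≟ _)) v∈A (v≢x , v≢z)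

    length-remove₂ : ∀ {x z A} → x ∈ A → length (remove₂ x z A) < length A
    length-remove₂ {A = A} x∈A =
      filter-notAll (λ v → ¬? (v ≟ _) ×-dec ¬? (v ≟ _)) A (Any.map (λ { refl (x≢x , _) → x≢x refl }) x∈A)

  extend : ∀ {A x z} → x ∈ A → z ∈ A → Kin x z → Pairing (remove₂ x z A) → Pairing A
  extend {A} {x} {z} x∈A z∈A x~z P = record
    { partner = π ; involutive = involutive ; fixes-outside = fixes-outside ; kin = kin }
    where
    open Pairing P renaming (partner to σ; involutive to σ-involutive; fixes-outside to σ-fixes; kin to σ-kin)

    σ-fixes-removed : ∀ {y} → y ≡ x ⊎ y ≡ z → σ y ≡ y
    σ-fixes-removed (inj₁ refl) = σ-fixes λ x∈ → proj₁ (proj₂ (∈-remove₂⁻ x∈)) refl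
    σ-fixes-removed (inj₂ refl) = σ-fixes λ z∈ → proj₂ (proj₂ (∈-remove₂⁻ z∈)) refl

    σ-avoids : ∀ {v y} → v ≢ y → σ y ≡ y → σ v ≢ y
    σ-avoids v≢y σy≡y σv≡y = v≢y (trans (sym (σ-involutive _)) (trans (cong σ σv≡y) σy≡y))

    π : V → V
    π v with v ≟ x | v ≟ z
    ... | yes _ | _     = z
    ... | no _  | yes _ = x
    ... | no _  | no _  = σ v

    π-x : π x ≡ z
    π-x with x ≟ x | x ≟ z
    ... | yes _   | _ = refl
    ... | no x≢x  | _ = ⊥-elim (x≢x refl)

    π-z : π z ≡ x
    π-z with z ≟ x | z ≟ z
    ... | yes refl | _     = refl
    ... | no _     | yes _ = refl
    ... | no _     | no z≢z = ⊥-elim (z≢z refl)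

    π-other : ∀ {v} → v ≢ x → v ≢ z → π v ≡ σ v
    π-other {v} v≢x v≢z with v ≟ x | v ≟ z
    ... | yes v≡x | _       = ⊥-elim (v≢x v≡x)
    ... | no _    | yes v≡z = ⊥-elim (v≢z v≡z)
    ... | no _    | no _    = refl

    involutive : ∀ v → π (π v) ≡ v
    involutive v with v ≟ x | v ≟ z
    ... | yes refl | _        = π-z
    ... | no _     | yes refl = π-x
    ... | no v≢x   | no v≢z   =
      trans (π-other (σ-avoids v≢x (σ-fixes-removed (inj₁ refl))) (σ-avoids v≢z (σ-fixes-removed (inj₂ refl))))
            (σ-involutive v)

    fixes-outside : ∀ {v} → v ∉ A → π v ≡ v
    fixes-outside v∉A =
      trans (π-other (λ { refl → v∉A x∈A }) (λ { refl → v∉A z∈A })) (σ-fixes (v∉A ∘ proj₁ ∘ ∈-remove₂⁻))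

    kin : ∀ {v} → v ∈ A → v ≢ r → Kin v (π v)
    kin {v} v∈A v≢r with v ≟ x | v ≟ z
    ... | yes refl | _        = x~z
    ... | no _     | yes refl = kin-sym x~z
    ... | no v≢x   | no v≢z   = σ-kin (∈-remove₂⁺ v∈A v≢x v≢z) v≢r

  Deepest : List V → V → Set
  Deepest A x = x ∈ A × x ≢ r × (∀ {v} → v ∈ A → v ≢ r → depth v ≤ℕ depth x)

  deepest : ∀ A → (∀ {v} → v ∈ A → v ≡ r) ⊎ ∃ (Deepest A)
  deepest A = go (filter nonRoot? A) (∈-filter⁻ nonRoot?) (∈-filter⁺ nonRoot?)
    where
    nonRoot? : ∀ v → Dec (v ≢ r)
    nonRoot? v = ¬? (v ≟ r)
    go : ∀ B → (∀ {v} → v ∈ B → v ∈ A × v ≢ r) → (∀ {v} → v ∈ A → v ≢ r → v ∈ B) →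
         (∀ {v} → v ∈ A → v ≡ r) ⊎ ∃ (Deepest A)
    go []       _     complete = inj₁ λ {v} v∈A → decidable-stable (v ≟ r) λ v≢r → case complete v∈A v≢r of λ ()
    go (b ∷ bs) sound complete = inj₂ (x , x∈A , x≢r , λ v∈A v≢r → below (complete v∈A v≢r))
      where
      x : V
      x = argmax depth b bs
      x∈A×x≢r : x ∈ A × x ≢ r
      x∈A×x≢r = argmax-all depth (sound (here refl)) (All.tabulate (sound ∘ there))
      x∈A : x ∈ A
      x∈A = proj₁ x∈A×x≢r
      x≢r : x ≢ r
      x≢r = proj₂ x∈A×x≢r
      below : ∀ {v} → v ∈ b ∷ bs → depth v ≤ℕ depth x
      below (here refl)  = f[⊥]≤f[argmax] {f = depth} b bs
      below (there v∈bs) = All.lookup (f[xs]≤f[argmax] {f = depth} b bs) v∈bs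

  -- A deepest x has no children in A, so A stays parent-closed after removing x together with a
  -- vertex of the same depth, or together with parent x when x has no sibling in A.
  module _ {A : List V} (closed : ParentClosed A) {x} (x∈A : x ∈ A) (x≢r : x ≢ r)
           (isDeepest : ∀ {v} → v ∈ A → v ≢ r → depth v ≤ℕ depth x) where

    parent≢deepest : ∀ {v w} → v ∈ A → v ≢ r → depth w ≡ depth x → parent v ≢ w
    parent≢deepest v∈A v≢r dw≡dx refl =
      <-irrefl dw≡dx (<-≤-trans (childOf⇒depth< (v≢r , refl)) (isDeepest v∈A v≢r))

    closed-without-sibling : ∀ {y} → Sibling x y → ParentClosed (remove₂ x y A)
    closed-without-sibling x~y v∈ v≢r with v∈A , _ ← ∈-remove₂⁻ v∈ =
      ∈-remove₂⁺ (closed v∈A v≢r) (parent≢deepest v∈A v≢r refl)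
                 (parent≢deepest v∈A v≢r (sym (depth-sibling x~y)))

    closed-without-parent : (∀ {y} → y ∈ A → ¬ Sibling x y) → ParentClosed (remove₂ x (parent x) A)
    closed-without-parent noSibling v∈ v≢r with v∈A , v≢x , _ ← ∈-remove₂⁻ v∈ =
      ∈-remove₂⁺ (closed v∈A v≢r) (parent≢deepest v∈A v≢r refl)
                 (λ pv≡px → noSibling v∈A (≢-sym v≢x , x≢r , v≢r , sym pv≡px))

    partnerOfDeepest : Σ V λ z → z ∈ A × Kin x z × ParentClosed (remove₂ x z A)
    partnerOfDeepest with Any.any? (sibling? x) A
    ... | yes hasSibling with y , y∈A , x~y ← find hasSibling = y , y∈A , inj₁ x~y , closed-without-sibling x~y
    ... | no noSibling =
      parent x , closed x∈A x≢r , inj₂ (inj₁ (x≢r , refl)) ,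
      closed-without-parent λ y∈A x~y → noSibling (lose y∈A x~y)

  pairing : (A : List V) → ParentClosed A → Pairing A
  pairing A = go A (<-wellFounded (length A))
    where
    go : (A : List V) → Acc _<_ (length A) → ParentClosed A → Pairing A
    go A (acc smaller) closed with deepest A
    ... | inj₁ onlyRoot = identityPairing onlyRoot
    ... | inj₂ (x , x∈A , x≢r , isDeepest) with partnerOfDeepest closed x∈A x≢r isDeepest
    ...   | z , z∈A , x~z , closed′ =
      extend x∈A z∈A x~z (go (remove₂ x z A) (smaller (length-remove₂ x∈A)) closed′)

  treePairing : Pairing (allFin (n G))
  treePairing = pairing (allFin (n G)) (λ _ _ → ∈-allFin _)

  treePairing-fixed⇒root : ∀ {v} → Pairing.partner treePairing v ≡ v → v ≡ r
  treePairing-fixed⇒root {v} fixed = decidable-stable (v ≟ r) λ v≢r → moves treePairing (∈-allFin v) v≢r fixed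

  treeEdge⇒adj : ∀ {x y} → TreeEdge x y → Adj G x y
  treeEdge⇒adj (inj₁ (x≢r , refl)) = parent-adj x≢r
  treeEdge⇒adj (inj₂ (y≢r , refl)) = swap (parent-adj y≢r)

  toChain : ∀ {x xs y} → Path x xs y → Chain G x xs y
  toChain end          = end
  toChain (link xy p) = link (treeEdge⇒adj xy) (toChain p)

  edge-ordered : ∀ {a b} → (a , b) ∈ edges G → toℕ a < toℕ b
  edge-ordered = All.lookup (ordered G)

  module _ (acyclic : Acyclic G) where

    -- A simple tree path from a to b that is not the edge ab itself closes a cycle with ab.
    edge⇒treeEdge : ∀ {a b} → (a , b) ∈ edges G → TreeEdge a b
    edge⇒treeEdge {a} {b} ab∈E with shorten _≟_ (proj₂ (treePath a b))
    ... | []           , end                     , _      = ⊥-elim (<-irrefl refl (edge-ordered ab∈E))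
    ... | _ ∷ []       , link a~b end            , _      = a~b
    ... | y₁ ∷ y₂ ∷ ys , path@(link _ (link _ _)) , unique = ⊥-elim (acyclic record
      { v₀ = a ; v₁ = y₁ ; v₂ = y₂ ; rest = ys ; last = b
      ; chain = toChain path ; closing = inj₂ ab∈E ; distinct = unique })

    child : V × V → V
    child (a , b) with childOf? a b
    ... | yes _ = a
    ... | no _  = b

    parentEdge : V → V × V
    parentEdge w with (w , parent w) ∈? edges G
    ... | yes _ = w , parent w
    ... | no _  = parent w , w

    parentEdge-∈ : ∀ {w} → w ≢ r → parentEdge w ∈ edges G
    parentEdge-∈ {w} w≢r with (w , parent w) ∈? edges G | parent-adj w≢r
    ... | yes e∈ | _       = e∈
    ... | no e∉  | inj₁ e∈ = ⊥-elim (e∉ e∈)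
    ... | no _   | inj₂ e∈ = e∈

    child-parentEdge : ∀ {w} → w ≢ r → child (parentEdge w) ≡ w
    child-parentEdge {w} w≢r with (w , parent w) ∈? edges G
    ... | yes _ with childOf? w (parent w)
    ...   | yes _  = refl
    ...   | no ¬c  = ⊥-elim (¬c (w≢r , refl))
    child-parentEdge {w} w≢r | no _ with childOf? (parent w) w
    ...   | yes c  = ⊥-elim (<-asym (childOf⇒depth< c) (childOf⇒depth< (w≢r , refl)))
    ...   | no _   = refl

    parentEdge-child : ∀ {e} → e ∈ edges G → child e ≢ r × parentEdge (child e) ≡ e
    parentEdge-child {a , b} e∈ with childOf? a b
    ... | yes (a≢r , refl) with (a , parent a) ∈? edges G
    ...   | yes _ = a≢r , refl
    ...   | no e∉ = ⊥-elim (e∉ e∈)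
    parentEdge-child {a , b} e∈ | no ¬ab with edge⇒treeEdge e∈
    ...   | inj₁ ab = ⊥-elim (¬ab ab)
    ...   | inj₂ (b≢r , refl) with (b , parent b) ∈? edges G
    ...     | yes ba∈ = ⊥-elim (<-asym (edge-ordered e∈) (edge-ordered ba∈))
    ...     | no _    = b≢r , refl

    parentEdge-injective : ∀ {w w′} → w ≢ r → w′ ≢ r → parentEdge w ≡ parentEdge w′ → w ≡ w′
    parentEdge-injective w≢r w′≢r eq =
      trans (sym (child-parentEdge w≢r)) (trans (cong child eq) (child-parentEdge w′≢r))

    edgeLabel-parentEdge : ∀ lab w → edgeLabel lab (parentEdge w) ≡ labelOf lab w xor labelOf lab (parent w)
    edgeLabel-parentEdge lab w with (w , parent w) ∈? edges G
    ... | yes _ = refl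
    ... | no _  = xor-comm (labelOf lab (parent w)) (labelOf lab w)

    module _ (P : Pairing (allFin (n G))) (lab : Labelling (n G)) (balanced : Balanced (Pairing.partner P) lab) where
      open Pairing P using (partner; involutive; kin)

      L : V → Bool
      L = labelOf lab

      monochromatic bichromatic : List (V × V)
      monochromatic = filter (λ e → edgeLabel lab e ≟ᵇ false) (edges G)
      bichromatic   = filter (λ e → edgeLabel lab e ≟ᵇ true) (edges G)

      monochromatic-child : ∀ {e} → e ∈ monochromatic →
                            e ∈ edges G × child e ≢ r × L (child e) ≡ L (parent (child e))
      monochromatic-child {e} e∈ with e∈E , label≡false ← ∈-filter⁻ (λ e → edgeLabel lab e ≟ᵇ false) {xs = edges G} e∈
                                   with c≢r , e≡ ← parentEdge-child e∈E =
        e∈E , c≢r , xor≡false⇒≡ _ _ (begin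
          L (child e) xor L (parent (child e)) ≡⟨ sym (edgeLabel-parentEdge lab (child e)) ⟩
          edgeLabel lab (parentEdge (child e)) ≡⟨ cong (edgeLabel lab) e≡ ⟩
          edgeLabel lab e                      ≡⟨ label≡false ⟩
          false                                ∎)
        where open ≡-Reasoning

      partner-differs : ∀ {c} → c ≢ r → L c ≢ L (partner c)
      partner-differs {c} c≢r = balanced c (moves P (∈-allFin c) c≢r)

      partner-of-monochromatic : ∀ {c} → c ≢ r → L c ≡ L (parent c) →
                                 partner c ≢ r × L (partner c) ≢ L (parent (partner c))
      partner-of-monochromatic {c} c≢r same with kin (∈-allFin c) c≢r
      ... | inj₁ (_ , _ , π≢r , pc≡pπ) =
        π≢r , λ eq → partner-differs c≢r (trans same (trans (cong L pc≡pπ) (sym eq)))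
      ... | inj₂ (inj₁ (_ , pc≡π))     = ⊥-elim (partner-differs c≢r (trans same (cong L pc≡π)))
      ... | inj₂ (inj₂ (π≢r , pπ≡c))   = π≢r , λ eq → partner-differs c≢r (sym (trans eq (cong L pπ≡c)))

      toBichromatic : V × V → V × V
      toBichromatic e = parentEdge (partner (child e))

      toBichromatic-∈ : ∀ {e} → e ∈ monochromatic → toBichromatic e ∈ bichromatic
      toBichromatic-∈ {e} e∈ with _ , c≢r , same ← monochromatic-child e∈
                            with π≢r , differ ← partner-of-monochromatic c≢r same =
        ∈-filter⁺ (λ e → edgeLabel lab e ≟ᵇ true) (parentEdge-∈ π≢r)
                  (trans (edgeLabel-parentEdge lab (partner (child e))) (≢⇒xor≡true differ))

      toBichromatic-injective : ∀ {e e′} → e ∈ monochromatic → e′ ∈ monochromatic →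
                                toBichromatic e ≡ toBichromatic e′ → e ≡ e′
      toBichromatic-injective {e} {e′} e∈ e′∈ eq
        with e∈E , c≢r , same ← monochromatic-child e∈ | e′∈E , c′≢r , same′ ← monochromatic-child e′∈ = begin
          e                     ≡⟨ sym (proj₂ (parentEdge-child e∈E)) ⟩
          parentEdge (child e)  ≡⟨ cong parentEdge same-child ⟩
          parentEdge (child e′) ≡⟨ proj₂ (parentEdge-child e′∈E) ⟩
          e′                    ∎
        where
        open ≡-Reasoning
        same-partner : partner (child e) ≡ partner (child e′)
        same-partner = parentEdge-injective (proj₁ (partner-of-monochromatic c≢r same))
                                            (proj₁ (partner-of-monochromatic c′≢r same′)) eq
        same-child : child e ≡ child e′
        same-child = trans (sym (involutive _)) (trans (cong partner same-partner) (involutive _))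

      balanced⇒nonneg : + 0 ≤ discrepancy G lab
      balanced⇒nonneg = i≤j⇒0≤j-i (+≤+ (length-≤-of-injection _≟ᵉ_ toBichromatic
        (Unique-filter⁺ (λ e → edgeLabel lab e ≟ᵇ false) (nodup G)) toBichromatic-∈ toBichromatic-injective))

theorem3p2 : (T : Graph) → IsTree T → (+ 0 ≤ bA T) × (+ 0 ≤ bI T)
theorem3p2 T (nonempty , connected , acyclic) = admirable-first nonneg , impish-first nonneg
  where
  r : Fin (n T)
  r = fromℕ< nonempty
  open Rooted T r connected
  open Pairing treePairing using (partner; involutive)
  open PairingStrategy T partner involutive r treePairing-fixed⇒root
  nonneg : ∀ lab → Balanced partner lab → + 0 ≤ discrepancy T lab
  nonneg = balanced⇒nonneg acyclic treePairing
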